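{- Let $n$, $m$ and $t$ be positive integers with $m\le \left\lfloor \frac{n}{t+1}\right\rfloor$. Then $$p^{(t)}(n,m)=p^{(t)}(n-m,m)+p^{(t)}(n,m+1).$$
   Context: A partition of a positive integer $n$ is a finite sequence $\lambda=[\lambda_1,\lambda_2,\ldots,\lambda_k]$ of positive integers with $\lambda_1\ge\lambda_2\ge\cdots\ge\lambda_k$ and $\lambda_1+\cdots+\lambda_k=n$; we write $\lambda\vdash n$. For positive integers $n,m,t$, $p^{(t)}(n,m)$ denotes the number of partitions $\lambda\vdash n$ all of whose parts are at least $m$ and which satisfy $\lambda_1\ge t\cdot\lambda_2$. The one-part partition $[n]$ is considered to satisfy this condition, so it is counted whenever $n\ge m$. -}

module Defs where

open import Data.Nat using (ℕ; zero; suc; _+_; _*_; _≤_; _≥_)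
open import Data.Nat.Properties using (_≟_; _≤?_; _≥?_)
open import Data.List using (List; []; _∷_; map; concatMap; upTo; filter; length)
open import Data.Nat.ListAction using (sum)
open import Data.List.Relation.Unary.All using (All; all?)
open import Data.List.Relation.Unary.Linked using (Linked; linked?)
open import Data.Product using (_×_)
open import Data.Unit using (⊤)
open import Relation.Nullary using (Dec; yes)
open import Relation.Nullary.Decidable using (_×-dec_)
open import Relation.Binary.PropositionalEquality using (_≡_)

IsPartition : ℕ → List ℕ → Set
IsPartition n λs = All (1 ≤_) λs × Linked _≥_ λs × sum λs ≡ n

-- λ₁ ≥ t·λ₂ ; lists with fewer than two parts satisfy it vacuously
-- (in particular the one-part partition [n]).
FirstDominates : ℕ → List ℕ → Set
FirstDominates t (a ∷ b ∷ _) = a ≥ t * b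
FirstDominates t _           = ⊤

firstDominates? : ∀ t λs → Dec (FirstDominates t λs)
firstDominates? t []          = yes _
firstDominates? t (a ∷ [])    = yes _
firstDominates? t (a ∷ b ∷ _) = a ≥? t * b

Counted : ℕ → ℕ → ℕ → List ℕ → Set
Counted t n m λs = IsPartition n λs × All (m ≤_) λs × FirstDominates t λs

counted? : ∀ t n m λs → Dec (Counted t n m λs)
counted? t n m λs =
  (all? (1 ≤?_) λs ×-dec (linked? _≥?_ λs ×-dec (sum λs ≟ n)))
  ×-dec (all? (m ≤?_) λs ×-dec firstDominates? t λs)

listsOfLength : ℕ → ℕ → List (List ℕ)
listsOfLength n zero    = [] ∷ []
listsOfLength n (suc k) =
  concatMap (λ x → map (x ∷_) (listsOfLength n k)) (map suc (upTo n))

-- All lists of length ≤ n with entries in {1,…,n}; every partition of n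
-- occurs exactly once in this list.
candidates : ℕ → List (List ℕ)
candidates n = concatMap (listsOfLength n) (upTo (suc n))

p[_] : ℕ → ℕ → ℕ → ℕ
p[ t ] n m = length (filter (counted? t n m) (candidates n))

module Submission where

-- Split the partitions counted by p^(t)(n,m) according to whether every part
-- is at least m+1.  Those that are form exactly the set counted by
-- p^(t)(n,m+1).  The others have m as smallest, hence last, part; removing
-- that last part is a bijection onto the set counted by p^(t)(n-m,m).  Its
-- inverse, appending a part m, keeps λ₁ ≥ t·λ₂ except possibly when the
-- partition of n-m is the single part [n-m]; there it needs n-m ≥ t·m, i.e.
-- (t+1)·m ≤ n, which is what m ≤ ⌊n/(t+1)⌋ provides.

open import Defs
open import Data.Nat using (ℕ; zero; suc; _+_; _*_; _∸_; _≤_; _≥_; z≤n; s≤s)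
open import Data.Nat.DivMod using (_/_; m/n*n≤m)
open import Data.Nat.Properties
open import Data.Nat.ListAction using (sum)
open import Data.Nat.ListAction.Properties using (sum-++)
open import Data.List using (List; []; _∷_; [_]; _++_; map; concatMap; upTo; filter; length; head)
open import Data.List.Properties using (length-map; ∷-injectiveʳ; ++-cancelʳ)
open import Data.List.Membership.Propositional using (_∈_; find; lose)
open import Data.List.Membership.Propositional.Properties
  using (∈-map⁺; ∈-map⁻; ∈-filter⁺; ∈-filter⁻; ∈-concatMap⁺; ∈-concatMap⁻; ∈-upTo⁺)
open import Data.List.Membership.Propositional.Properties.WithK using (unique∧set⇒bag)
open import Data.List.Relation.Binary.BagAndSetEquality using (∼bag⇒↭)
open import Data.List.Relation.Binary.Permutation.Propositional.Properties using (↭-length)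
open import Data.List.Relation.Unary.Any using (here)
open import Data.List.Relation.Unary.All as All using (All; []; _∷_; all?)
import Data.List.Relation.Unary.All.Properties as AllP
open import Data.List.Relation.Unary.Linked using (Linked; []; [-]; _∷_)
open import Data.List.Relation.Unary.Unique.Propositional using (Unique)
import Data.List.Relation.Unary.Unique.Propositional.Properties as Unique
open import Data.List.Relation.Unary.AllPairs using ([]; _∷_)
open import Data.Maybe using (fromMaybe)
open import Data.Product using (_×_; _,_; proj₁; ∃)
open import Data.Empty using (⊥-elim)
open import Data.Unit using (tt)
open import Function.Base using (id)
open import Function.Bundles using (mk⇔)
open import Function.Definitions using (Injective)
open import Relation.Binary.PropositionalEquality using (_≡_; refl; sym; trans; cong; cong₂; subst; module ≡-Reasoning)
open import Relation.Nullary using (¬_; yes; no; ¬?)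
open import Relation.Nullary.Decidable using (_×-dec_)
open import Relation.Unary using (Pred; Decidable)
open import Level using (0ℓ)

same-length : {A : Set} {xs ys : List A} → Unique xs → Unique ys →
  (∀ {z} → z ∈ xs → z ∈ ys) → (∀ {z} → z ∈ ys → z ∈ xs) → length xs ≡ length ys
same-length uxs uys to from = ↭-length (∼bag⇒↭ (unique∧set⇒bag uxs uys (mk⇔ to from)))

length-filter-split : {A : Set} {P Q : Pred A 0ℓ} (P? : Decidable P) (Q? : Decidable Q) (xs : List A) →
  length (filter P? xs) ≡ length (filter (λ x → P? x ×-dec Q? x) xs)
                        + length (filter (λ x → P? x ×-dec ¬? (Q? x)) xs)
length-filter-split P? Q? [] = refl
length-filter-split P? Q? (x ∷ xs) with P? x | Q? x
... | yes _ | yes _ = cong suc (length-filter-split P? Q? xs)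
... | yes _ | no _  = trans (cong suc (length-filter-split P? Q? xs)) (sym (+-suc _ _))
... | no _  | yes _ = length-filter-split P? Q? xs
... | no _  | no _  = length-filter-split P? Q? xs

record Enumerates {A : Set} (R : Pred A 0ℓ) (xs : List A) : Set where
  field
    unique   : Unique xs
    complete : ∀ {z} → R z → z ∈ xs

open Enumerates

enumerates-⊆ : {A : Set} {P R : Pred A 0ℓ} {xs : List A} →
  (∀ {z} → P z → R z) → Enumerates R xs → Enumerates P xs
enumerates-⊆ P⇒R e = record { unique = unique e ; complete = λ p → complete e (P⇒R p) }

count-transfer : {A B : Set} {P : Pred A 0ℓ} {Q : Pred B 0ℓ} {xs : List A} {ys : List B}
  (P? : Decidable P) (Q? : Decidable Q) (f : B → A) → Injective _≡_ _≡_ f →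
  Enumerates P xs → Enumerates Q ys →
  (∀ {y} → Q y → P (f y)) → (∀ {z} → P z → ∃ λ y → Q y × f y ≡ z) →
  length (filter P? xs) ≡ length (filter Q? ys)
count-transfer {xs = xs} {ys} P? Q? f f-inj eP eQ preserve onto = begin
  length (filter P? xs)          ≡⟨ same-length (Unique.filter⁺ P? (unique eP))
                                      (Unique.map⁺ f-inj (Unique.filter⁺ Q? (unique eQ))) to from ⟩
  length (map f (filter Q? ys))  ≡⟨ length-map f (filter Q? ys) ⟩
  length (filter Q? ys)          ∎
  where
  open ≡-Reasoning
  to : ∀ {z} → z ∈ filter P? xs → z ∈ map f (filter Q? ys)
  to z∈ with ∈-filter⁻ P? {xs = xs} z∈
  ... | _ , pz with onto pz
  ... | y , qy , refl = ∈-map⁺ f (∈-filter⁺ Q? (complete eQ qy) qy)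
  from : ∀ {z} → z ∈ map f (filter Q? ys) → z ∈ filter P? xs
  from z∈ with ∈-map⁻ f z∈
  ... | y , y∈ , refl with ∈-filter⁻ Q? {xs = ys} y∈
  ... | _ , qy = ∈-filter⁺ P? (complete eP (preserve qy)) (preserve qy)

concatMap-unique : {A B : Set} (g : A → List B) (key : B → A) →
  (∀ h {y} → y ∈ g h → key y ≡ h) → (∀ h → Unique (g h)) →
  ∀ {hs} → Unique hs → Unique (concatMap g hs)
concatMap-unique g key key-g unique-g {[]} [] = []
concatMap-unique g key key-g unique-g {h ∷ hs} (h∉hs ∷ unique-hs) =
  Unique.++⁺ (unique-g h) (concatMap-unique g key key-g unique-g unique-hs) disjoint
  where
  disjoint : ∀ {v} → ¬ (v ∈ g h × v ∈ concatMap g hs)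
  disjoint (v∈gh , v∈rest) with find (∈-concatMap⁻ g v∈rest)
  ... | h′ , h′∈hs , v∈gh′ = All.lookup h∉hs h′∈hs (trans (sym (key-g h v∈gh)) (key-g h′ v∈gh′))

listsOfLength-length : ∀ n k {y} → y ∈ listsOfLength n k → length y ≡ k
listsOfLength-length n zero (here refl) = refl
listsOfLength-length n (suc k) y∈ with find (∈-concatMap⁻ (λ x → map (x ∷_) (listsOfLength n k)) {xs = map suc (upTo n)} y∈)
... | _ , _ , y∈block with ∈-map⁻ _ y∈block
... | z , z∈ , refl = cong suc (listsOfLength-length n k z∈)

-- Lists of a fixed length are told apart blockwise by their first entry.
listsOfLength-unique : ∀ n k → Unique (listsOfLength n k)
listsOfLength-unique n zero = [] ∷ []
listsOfLength-unique n (suc k) =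
  concatMap-unique (λ x → map (x ∷_) (listsOfLength n k)) firstEntry firstEntry-block
    (λ _ → Unique.map⁺ ∷-injectiveʳ (listsOfLength-unique n k))
    (Unique.map⁺ suc-injective (Unique.upTo⁺ n))
  where
  firstEntry : List ℕ → ℕ
  firstEntry y = fromMaybe 0 (head y)
  firstEntry-block : ∀ h {y} → y ∈ map (h ∷_) (listsOfLength n k) → firstEntry y ≡ h
  firstEntry-block h y∈ with ∈-map⁻ _ y∈
  ... | _ , _ , refl = refl

listsOfLength-complete : ∀ n (y : List ℕ) → All (λ x → 1 ≤ x × x ≤ n) y →
  y ∈ listsOfLength n (length y)
listsOfLength-complete n [] [] = here refl
listsOfLength-complete n (suc a ∷ y) ((_ , a<n) ∷ bounds) =
  ∈-concatMap⁺ (λ x → map (x ∷_) (listsOfLength n (length y)))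
    (lose (∈-map⁺ suc (∈-upTo⁺ a<n)) (∈-map⁺ (suc a ∷_) (listsOfLength-complete n y bounds)))

parts≤sum : ∀ (y : List ℕ) → All (_≤ sum y) y
parts≤sum [] = []
parts≤sum (a ∷ y) = m≤m+n a (sum y) ∷ All.map (λ p → ≤-trans p (m≤n+m (sum y) a)) (parts≤sum y)

length≤sum : ∀ (y : List ℕ) → All (1 ≤_) y → length y ≤ sum y
length≤sum [] [] = z≤n
length≤sum (a ∷ y) (1≤a ∷ pos) = +-mono-≤ 1≤a (length≤sum y pos)

candidates-enumerate : ∀ n → Enumerates (IsPartition n) (candidates n)
candidates-enumerate n = record
  { unique   = concatMap-unique (listsOfLength n) length (listsOfLength-length n)
                 (listsOfLength-unique n) (Unique.upTo⁺ (suc n))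
  ; complete = contains-partition
  }
  where
  contains-partition : ∀ {y} → IsPartition n y → y ∈ candidates n
  contains-partition {y} (pos , _ , refl) =
    ∈-concatMap⁺ (listsOfLength (sum y))
      (lose (∈-upTo⁺ (s≤s (length≤sum y pos)))
            (listsOfLength-complete (sum y) y (All.zip (pos , parts≤sum y))))

linked-snoc : {A : Set} {R : A → A → Set} {m : A} (x : List A) →
  Linked R x → All (λ a → R a m) x → Linked R (x ++ [ m ])
linked-snoc []          _          _          = [-]
linked-snoc (a ∷ [])    _          (Ram ∷ _)  = Ram ∷ [-]
linked-snoc (a ∷ b ∷ x) (Rab ∷ lk) (_ ∷ Rxm)  = Rab ∷ linked-snoc (b ∷ x) lk Rxm

linked-init : {A : Set} {R : A → A → Set} {m : A} (x : List A) →
  Linked R (x ++ [ m ]) → Linked R x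
linked-init []          _          = []
linked-init (a ∷ [])    _          = [-]
linked-init (a ∷ b ∷ x) (Rab ∷ lk) = Rab ∷ linked-init (b ∷ x) lk

sum-snoc : ∀ (x : List ℕ) m → sum (x ++ [ m ]) ≡ sum x + m
sum-snoc x m = trans (sum-++ x [ m ]) (cong (sum x +_) (+-identityʳ m))

-- Appending m can only create a new second part when x = [a], where a = sum x.
firstDominates-snoc : ∀ t m (x : List ℕ) → t * m ≤ sum x →
  FirstDominates t x → FirstDominates t (x ++ [ m ])
firstDominates-snoc t m []          _    _  = tt
firstDominates-snoc t m (a ∷ [])    tm≤a _  = subst (t * m ≤_) (+-identityʳ a) tm≤a
firstDominates-snoc t m (a ∷ b ∷ x) _    fd = fd

firstDominates-init : ∀ t m (x : List ℕ) → FirstDominates t (x ++ [ m ]) → FirstDominates t x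
firstDominates-init t m []          _  = tt
firstDominates-init t m (a ∷ [])    _  = tt
firstDominates-init t m (a ∷ b ∷ x) fd = fd

AllAbove : ℕ → List ℕ → Set
AllAbove m = All (suc m ≤_)

allAbove? : ∀ m → Decidable (AllAbove m)
allAbove? m = all? (suc m ≤?_)

ends-with-smallest : ∀ {m} (y : List ℕ) → Linked _≥_ y → All (m ≤_) y → ¬ AllAbove m y →
  ∃ λ x → y ≡ x ++ [ m ]
ends-with-smallest []          _         _          not-above = ⊥-elim (not-above [])
ends-with-smallest {m} (a ∷ []) _        (m≤a ∷ []) not-above with m <? a
... | yes m<a = ⊥-elim (not-above (m<a ∷ []))
... | no  m≮a = [] , cong [_] (≤-antisym (≮⇒≥ m≮a) m≤a)
ends-with-smallest {m} (a ∷ b ∷ y) (a≥b ∷ lk) (_ ∷ m≤rest) not-above with allAbove? m (b ∷ y)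
... | yes (m<b ∷ above) = ⊥-elim (not-above (≤-trans m<b a≥b ∷ m<b ∷ above))
... | no  not-above′ with ends-with-smallest (b ∷ y) lk m≤rest not-above′
... | x , b∷y≡x++m = a ∷ x , cong (a ∷_) b∷y≡x++m

snoc-not-above : ∀ m (x : List ℕ) → ¬ AllAbove m (x ++ [ m ])
snoc-not-above m x above with AllP.++⁻ʳ x above
... | m<m ∷ [] = n≮n m m<m

append-part : ∀ t n m x → 1 ≤ m → suc t * m ≤ n →
  Counted t (n ∸ m) m x → Counted t n m (x ++ [ m ])
append-part t n m x 1≤m room ((pos , decr , sum≡) , ≥m , fd) =
  (AllP.++⁺ pos (1≤m ∷ []) , linked-snoc x decr ≥m , sum≡n) ,
  AllP.++⁺ ≥m (≤-refl ∷ []) ,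
  firstDominates-snoc t m x (subst (t * m ≤_) (sym sum≡) tm≤n∸m) fd
  where
  m≤n : m ≤ n
  m≤n = m+n≤o⇒m≤o m room
  tm≤n∸m : t * m ≤ n ∸ m
  tm≤n∸m = m+n≤o⇒m≤o∸n (t * m) (subst (_≤ n) (+-comm m (t * m)) room)
  sum≡n : sum (x ++ [ m ]) ≡ n
  sum≡n = begin
    sum (x ++ [ m ])  ≡⟨ sum-snoc x m ⟩
    sum x + m         ≡⟨ cong (_+ m) sum≡ ⟩
    n ∸ m + m         ≡⟨ m∸n+n≡m m≤n ⟩
    n                 ∎
    where open ≡-Reasoning

remove-part : ∀ t n m x → Counted t n m (x ++ [ m ]) → Counted t (n ∸ m) m x
remove-part t n m x ((pos , decr , sum≡) , ≥m , fd) =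
  (AllP.++⁻ˡ x pos , linked-init x decr , sum≡n∸m) ,
  AllP.++⁻ˡ x ≥m , firstDominates-init t m x fd
  where
  sum≡n∸m : sum x ≡ n ∸ m
  sum≡n∸m = begin
    sum x                   ≡⟨ m+n∸n≡m (sum x) m ⟨
    sum x + m ∸ m           ≡⟨ cong (_∸ m) (sum-snoc x m) ⟨
    sum (x ++ [ m ]) ∸ m    ≡⟨ cong (_∸ m) sum≡ ⟩
    n ∸ m                   ∎
    where open ≡-Reasoning

count-all-above : ∀ t n m →
  length (filter (λ z → counted? t n m z ×-dec allAbove? m z) (candidates n)) ≡ p[ t ] n (suc m)
count-all-above t n m =
  count-transfer (λ z → counted? t n m z ×-dec allAbove? m z) (counted? t n (suc m)) id id
    (enumerates-⊆ (λ ((partition , _) , _) → partition) (candidates-enumerate n))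
    (enumerates-⊆ proj₁ (candidates-enumerate n))
    (λ (partition , above , fd) → (partition , All.map <⇒≤ above , fd) , above)
    (λ ((partition , _ , fd) , above) → _ , (partition , above , fd) , refl)

count-some-equal : ∀ t n m → 1 ≤ m → suc t * m ≤ n →
  length (filter (λ z → counted? t n m z ×-dec ¬? (allAbove? m z)) (candidates n))
    ≡ p[ t ] (n ∸ m) m
count-some-equal t n m 1≤m room =
  count-transfer (λ z → counted? t n m z ×-dec ¬? (allAbove? m z)) (counted? t (n ∸ m) m)
    (_++ [ m ]) (λ {x} {y} → ++-cancelʳ [ m ] x y)
    (enumerates-⊆ (λ ((partition , _) , _) → partition) (candidates-enumerate n))
    (enumerates-⊆ proj₁ (candidates-enumerate (n ∸ m)))
    (λ {x} counted → append-part t n m x 1≤m room counted , snoc-not-above m x)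
    remove-last
  where
  remove-last : ∀ {z} → Counted t n m z × ¬ AllAbove m z →
    ∃ λ x → Counted t (n ∸ m) m x × x ++ [ m ] ≡ z
  remove-last {z} (counted@((_ , decr , _) , ≥m , _) , not-above)
    with ends-with-smallest z decr ≥m not-above
  ... | x , refl = x , remove-part t n m x counted , refl

room-for-part : ∀ n m t → m ≤ n / suc t → suc t * m ≤ n
room-for-part n m t m≤n/[t+1] = begin
  suc t * m          ≡⟨ *-comm (suc t) m ⟩
  m * suc t          ≤⟨ *-monoˡ-≤ (suc t) m≤n/[t+1] ⟩
  n / suc t * suc t  ≤⟨ m/n*n≤m n (suc t) ⟩
  n                  ∎
  where open ≤-Reasoning

theorem1 : (n m t : ℕ) → 1 ≤ n → 1 ≤ m → 1 ≤ t → m ≤ n / suc t →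
    p[ t ] n m ≡ p[ t ] (n ∸ m) m + p[ t ] n (suc m)
theorem1 n m t _ 1≤m _ m≤n/[t+1] = begin
  p[ t ] n m                                   ≡⟨ length-filter-split (counted? t n m) (allAbove? m) (candidates n) ⟩
  length (filter all-above (candidates n)) + length (filter some-equal (candidates n))
                                               ≡⟨ +-comm (length (filter all-above (candidates n))) _ ⟩
  length (filter some-equal (candidates n)) + length (filter all-above (candidates n))
                                               ≡⟨ cong₂ _+_ (count-some-equal t n m 1≤m (room-for-part n m t m≤n/[t+1]))
                                                            (count-all-above t n m) ⟩
  p[ t ] (n ∸ m) m + p[ t ] n (suc m)          ∎
  where
  open ≡-Reasoning
  all-above : Decidable (λ z → Counted t n m z × AllAbove m z)
  all-above z = counted? t n m z ×-dec allAbove? m z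
  some-equal : Decidable (λ z → Counted t n m z × ¬ AllAbove m z)
  some-equal z = counted? t n m z ×-dec ¬? (allAbove? m z)
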